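{- Let $n\geq 4$ be an even integer, let $\mathbb{D}_{2n}=\langle a,b \mid a^n=b^2=1,\ ba=a^{n-1}b\rangle$, let $\Psi=\{ab, a^{2}b, \dots , a^{n-1}b, b\}\cup\{a^{n/2}\}$, and let $\Lambda=\mathrm{Cay}(\mathbb{D}_{2n}, \Psi)$. Then the minimum cardinality $\psi(\Lambda)$ of a doubly resolving set of $\Lambda$ is $n$.
   Context: For a finite group $G$ and an inverse-closed subset $Q\subseteq G\setminus\{1\}$, the Cayley graph $\mathrm{Cay}(G,Q)$ has vertex set $G$ and edge set $\{\{x,y\} : x^{ -1}y\in Q\}$. In a connected graph $\Gamma$ with distance $d$, vertices $x,y$ doubly resolve vertices $u,v$ if $d(u,x)-d(u,y)\neq d(v,x)-d(v,y)$. A set $S$ of vertices is a doubly resolving set if every two distinct vertices of $\Gamma$ are doubly resolved by some two vertices of $S$; $\psi(\Gamma)$ is the minimum cardinality of a doubly resolving set. -}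

module Defs where

open import Data.Nat as ℕ using (ℕ; zero; suc; NonZero; _<_)
open import Data.Nat.DivMod using (_%_; _/_; m%n<n)
open import Data.Fin using (Fin; toℕ; fromℕ<)
open import Data.Bool using (Bool; true; false; _xor_)
open import Data.Integer as ℤ using (ℤ; +_)
open import Data.Product using (_×_; _,_; ∃)
open import Data.Sum using (_⊎_)
open import Data.List using (List; length)
open import Data.List.Membership.Propositional using (_∈_)
open import Relation.Binary.PropositionalEquality using (_≡_; _≢_)
open import Relation.Nullary using (¬_)

-- The element  a^i b^s  (0 ≤ i < n, s ∈ {0,1}) is represented by
-- (i , s) with s = false meaning b^0 and s = true meaning b^1.

module Dihedral (n : ℕ) .{{_ : NonZero n}} where

  D : Set
  D = Fin n × Bool

  mod : ℕ → Fin n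
  mod k = fromℕ< (m%n<n k n)

  addF : Fin n → Fin n → Fin n
  addF i j = mod (toℕ i ℕ.+ toℕ j)

  negF : Fin n → Fin n
  negF i = mod (n ℕ.∸ toℕ i)

  -- b^s a^j = a^{(-1)^s j} b^s
  twist : Bool → Fin n → Fin n
  twist false j = j
  twist true  j = negF j

  -- (a^i b^s)(a^j b^t) = a^{i + (-1)^s j} b^{s+t}
  _·_ : D → D → D
  (i , s) · (j , t) = addF i (twist s j) , (s xor t)

  inv : D → D
  inv (i , false) = negF i , false
  inv (i , true)  = i , true

  unit : D
  unit = mod 0 , false

  Ψ : D → Set
  Ψ (i , s) = (s ≡ true) ⊎ ((s ≡ false) × (toℕ i ≡ n / 2))

  Adj : D → D → Set
  Adj x y = Ψ (inv x · y)

module Metric {V : Set} (Adj : V → V → Set) where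

  data Walk : ℕ → V → V → Set where
    here : ∀ {x} → Walk 0 x x
    step : ∀ {k x y z} → Adj x y → Walk k y z → Walk (suc k) x z

  Dist : V → V → ℕ → Set
  Dist u v k = Walk k u v × (∀ m → m < k → ¬ Walk m u v)

  DoublyResolves : V → V → V → V → Set
  DoublyResolves x y u v =
    ∀ k₁ k₂ k₃ k₄ → Dist u x k₁ → Dist u y k₂ → Dist v x k₃ → Dist v y k₄ →
      (+ k₁ ℤ.- + k₂) ≢ (+ k₃ ℤ.- + k₄)

  IsDoublyResolvingSet : List V → Set
  IsDoublyResolvingSet S =
    ∀ u v → u ≢ v → ∃ λ x → ∃ λ y → x ∈ S × y ∈ S × DoublyResolves x y u v

module Submission where

-- The Cayley graph Λ = Cay(D_{2n}, Ψ), n = 2q ≥ 4, has two layers {a^i} and {a^i b}.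
-- Every vertex of one layer is adjacent to every vertex of the other (x⁻¹y is a
-- reflection, and all reflections lie in Ψ), while inside a layer x⁻¹y is a rotation,
-- so x ~ y exactly when the exponents are antipodal (differ by q).  Hence Λ has
-- diameter 2, and inside a layer each class {c, c + q} (c < q) is an antipodal pair
-- that every other vertex sees at equal distance.
--   Lower bound: a doubly resolving set must contain a member of each such twin pair
--   (a general graph fact), and the 2q pairs are disjoint, so it has at least n vertices.
--   Upper bound: the lower halves {a^c b^s : c < q} of both layers form a doubly
--   resolving set of size n; u, v are separated using the "shadow" of u (the lower
--   member of its class in its layer) together with a vertex of the other layer, or,
--   when u, v lie in different layers, with the shadow of a different class.

open import Defs
open import Data.Nat using (ℕ; NonZero; _≤_)
open import Data.Nat.Divisibility using (_∣_)
open import Data.Product using (_×_; ∃)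
open import Data.List using (List; length)
open import Data.List.Relation.Unary.Unique.Propositional using (Unique)
open import Relation.Binary.PropositionalEquality using (_≡_)

open import Data.Nat using (zero; suc; _<_; _+_; _*_; _∸_; _≤?_; _<?_; s≤s; z≤n; >-nonZero; >-nonZero⁻¹)
open import Data.Nat.Properties
open import Data.Nat.DivMod
open import Data.Nat.Divisibility using (divides)
open import Data.Integer as ℤ using (ℤ)
import Data.Integer.Properties as ℤ
open import Data.Integer.Tactic.RingSolver using (solve-∀)
open import Data.Bool using (Bool; true; false; not)
import Data.Bool.Properties as Bool
open import Data.Fin as Fin using (Fin; toℕ; fromℕ<; remQuot; combine)
import Data.Fin.Properties as Fin
open import Data.Product using (Σ; _,_; proj₁; proj₂; uncurry)
open import Data.Product.Properties using (≡-dec)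
open import Data.Sum using (_⊎_; inj₁; inj₂)
open import Data.Empty using (⊥-elim)
open import Data.List using (lookup; map; allFin)
open import Data.List.Properties using (length-map; length-tabulate)
open import Data.List.Membership.Propositional using (_∈_)
open import Data.List.Membership.Propositional.Properties using (∈-map⁺; ∈-allFin)
import Data.List.Relation.Unary.Unique.Propositional.Properties as Unique
open import Data.List.Relation.Unary.Any using (index)
open import Data.List.Relation.Unary.Any.Properties using (lookup-index)
open import Function using (_∘_)
open import Function.Definitions using (Injective)
open import Relation.Nullary using (¬_; yes; no)
open import Relation.Binary.Definitions using (DecidableEquality; tri<; tri≈; tri>)
open import Relation.Binary.PropositionalEquality
open ≡-Reasoning

-- In an abelian group, w - x = y - z gives w + z = y + x; on ℤ this turns the
-- difference condition of double resolution into an equation between naturals.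
cross-differences : ∀ (w x y z : ℤ) → w ℤ.- x ≡ y ℤ.- z → w ℤ.+ z ≡ y ℤ.+ x
cross-differences w x y z e = begin
  w ℤ.+ z                     ≡⟨ insert w x z ⟩
  (w ℤ.- x) ℤ.+ (x ℤ.+ z)     ≡⟨ cong (ℤ._+ (x ℤ.+ z)) e ⟩
  (y ℤ.- z) ℤ.+ (x ℤ.+ z)     ≡⟨ insert′ y x z ⟨
  y ℤ.+ x                     ∎
  where
  insert : ∀ (a b c : ℤ) → a ℤ.+ c ≡ (a ℤ.- b) ℤ.+ (b ℤ.+ c)
  insert = solve-∀
  insert′ : ∀ (a b c : ℤ) → a ℤ.+ b ≡ (a ℤ.- c) ℤ.+ (b ℤ.+ c)
  insert′ = solve-∀

nat-differences : ∀ a b c d → (ℤ.+ a ℤ.- ℤ.+ b) ≡ (ℤ.+ c ℤ.- ℤ.+ d) → a + d ≡ c + b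
nat-differences a b c d e = ℤ.+-injective (begin
  ℤ.+ (a + d)          ≡⟨ ℤ.pos-+ a d ⟩
  ℤ.+ a ℤ.+ ℤ.+ d      ≡⟨ cross-differences (ℤ.+ a) (ℤ.+ b) (ℤ.+ c) (ℤ.+ d) e ⟩
  ℤ.+ c ℤ.+ ℤ.+ b      ≡⟨ ℤ.pos-+ c b ⟨
  ℤ.+ (c + b)          ∎)

injection-into-list : ∀ {A : Set} {m} (S : List A) (f : Fin m → A) →
  (∀ k → f k ∈ S) → Injective _≡_ _≡_ f → m ≤ length S
injection-into-list {m = m} S f f∈S f-injective = Fin.injective⇒≤ position-injective
  where
  position : Fin m → Fin (length S)
  position k = index (f∈S k)
  position-injective : Injective _≡_ _≡_ position
  position-injective {k} {k′} e = f-injective (begin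
    f k                    ≡⟨ lookup-index (f∈S k) ⟩
    lookup S (position k)  ≡⟨ cong (lookup S) e ⟩
    lookup S (position k′) ≡⟨ lookup-index (f∈S k′) ⟨
    f k′                   ∎)

module GraphMetric {V : Set} (Adj : V → V → Set) where
  open Metric Adj

  dist-unique : ∀ {u x k k′} → Dist u x k → Dist u x k′ → k ≡ k′
  dist-unique {k = k} {k′} (w , shortest) (w′ , shortest′) with <-cmp k k′
  ... | tri< k<k′ _ _ = ⊥-elim (shortest′ k k<k′ w)
  ... | tri≈ _ k≡k′ _ = k≡k′
  ... | tri> _ _ k>k′ = ⊥-elim (shortest k′ k>k′ w′)

  dist-zero : ∀ {u} → Dist u u 0
  dist-zero = here , λ _ ()

  dist-one : ∀ {u v} → u ≢ v → Adj u v → Dist u v 1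
  dist-one u≢v uv = step uv here , λ { zero _ here → u≢v refl ; (suc _) (s≤s ()) _ }

  dist-two : ∀ {u v} → u ≢ v → ¬ Adj u v → Walk 2 u v → Dist u v 2
  dist-two u≢v ¬uv w = w , λ { zero _ here → u≢v refl ; (suc zero) _ (step uv here) → ¬uv uv
                                   ; (suc (suc _)) (s≤s (s≤s ())) _ }

  resolves : ∀ {x y u v a b c d} → Dist u x a → Dist u y b → Dist v x c → Dist v y d →
    a + d ≢ c + b → DoublyResolves x y u v
  resolves ux uy vx vy a+d≢c+b k₁ k₂ k₃ k₄ ux′ uy′ vx′ vy′ e =
    a+d≢c+b (trans (cong₂ _+_ (dist-unique ux ux′) (dist-unique vy vy′))
            (trans (nat-differences k₁ k₂ k₃ k₄ e) (cong₂ _+_ (dist-unique vx′ vx) (dist-unique uy′ uy))))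

  Equidistant : V → V → V → Set
  Equidistant x u v = ∃ λ k → Dist u x k × Dist v x k

  equidistant-pair-fails : ∀ {x y u v} → Equidistant x u v → Equidistant y u v → ¬ DoublyResolves x y u v
  equidistant-pair-fails (k , ux , vx) (k′ , uy , vy) dr = dr k k′ k k′ ux uy vx vy refl

  module _ (_≟_ : DecidableEquality V) {u v : V}
           (twins : ∀ w → w ≢ u → w ≢ v → Equidistant w u v) where

    twin-or-equidistant : ∀ {S w} → w ∈ S → (u ∈ S ⊎ v ∈ S) ⊎ Equidistant w u v
    twin-or-equidistant {w = w} w∈S with w ≟ u | w ≟ v
    ... | yes refl | _ = inj₁ (inj₁ w∈S)
    ... | no _ | yes refl = inj₁ (inj₂ w∈S)
    ... | no w≢u | no w≢v = inj₂ (twins w w≢u w≢v)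

    drs-meets-twins : ∀ {S} → u ≢ v → IsDoublyResolvingSet S → u ∈ S ⊎ v ∈ S
    drs-meets-twins u≢v drs with drs u v u≢v
    ... | x , y , x∈S , y∈S , dr with twin-or-equidistant x∈S | twin-or-equidistant y∈S
    ...   | inj₁ hit | _ = hit
    ...   | inj₂ _ | inj₁ hit = hit
    ...   | inj₂ x-equi | inj₂ y-equi = ⊥-elim (equidistant-pair-fails x-equi y-equi dr)

module HalfTurns (q : ℕ) .{{_ : NonZero q}} where

  n : ℕ
  n = q * 2

  instance
    n-nonZero : NonZero n
    n-nonZero = m*n≢0 q 2

  n≡q+q : n ≡ q + q
  n≡q+q = trans (*-comm q 2) (cong (q +_) (+-identityʳ q))

  q<n : q < n
  q<n = subst (q <_) (sym n≡q+q) (m<m+n q (>-nonZero⁻¹ q))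

  Antipodal : ℕ → ℕ → Set
  Antipodal i j = (j ≡ i + q) ⊎ (i ≡ j + q)

  antipodal-sym : ∀ {i j} → Antipodal i j → Antipodal j i
  antipodal-sym (inj₁ e) = inj₂ e
  antipodal-sym (inj₂ e) = inj₁ e

  antipodal⇒≢ : ∀ {i j} → Antipodal i j → i ≢ j
  antipodal⇒≢ {i} (inj₁ e) refl = <⇒≢ (m<m+n i (>-nonZero⁻¹ q)) e
  antipodal⇒≢ {i} (inj₂ e) refl = <⇒≢ (m<m+n i (>-nonZero⁻¹ q)) e

  beyond : ∀ {j k} → j < n → j ≢ k + q + q
  beyond {j} {k} j<n refl = <⇒≱ j<n
    (≤-trans (≤-reflexive n≡q+q) (subst (q + q ≤_) (sym (+-assoc k q q)) (m≤n+m (q + q) k)))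

  antipode-unique : ∀ {i j k} → j < n → k < n → Antipodal i j → Antipodal i k → j ≡ k
  antipode-unique _   _   (inj₁ j≡i+q) (inj₁ k≡i+q) = trans j≡i+q (sym k≡i+q)
  antipode-unique _   _   (inj₂ i≡j+q) (inj₂ i≡k+q) = +-cancelʳ-≡ q _ _ (trans (sym i≡j+q) i≡k+q)
  antipode-unique j<n _   (inj₁ j≡i+q) (inj₂ i≡k+q) = ⊥-elim (beyond j<n (trans j≡i+q (cong (_+ q) i≡k+q)))
  antipode-unique _   k<n (inj₂ i≡j+q) (inj₁ k≡i+q) = ⊥-elim (beyond k<n (trans k≡i+q (cong (_+ q) i≡j+q)))

  -- ((n - i) mod n + j) mod n is the exponent of a^{-i} a^j, i.e. j - i modulo n.
  diff : ℕ → ℕ → ℕ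
  diff i j = ((n ∸ i) % n + j) % n

  diff-unfold : ∀ i {j} → j < n → diff i j ≡ (n ∸ i + j) % n
  diff-unfold i {j} j<n = begin
    ((n ∸ i) % n + j) % n       ≡⟨ cong (λ m → ((n ∸ i) % n + m) % n) (m<n⇒m%n≡m j<n) ⟨
    ((n ∸ i) % n + j % n) % n   ≡⟨ %-distribˡ-+ (n ∸ i) j n ⟨
    (n ∸ i + j) % n             ∎

  diff-≤ : ∀ {i j} → i ≤ j → j < n → diff i j ≡ j ∸ i
  diff-≤ {i} {j} i≤j j<n = begin
    diff i j               ≡⟨ diff-unfold i j<n ⟩
    (n ∸ i + j) % n        ≡⟨ cong (_% n) wrap ⟩
    (j ∸ i + n) % n        ≡⟨ [m+n]%n≡m%n (j ∸ i) n ⟩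
    (j ∸ i) % n            ≡⟨ m<n⇒m%n≡m (≤-<-trans (m∸n≤m j i) j<n) ⟩
    j ∸ i                  ∎
    where
    wrap : n ∸ i + j ≡ j ∸ i + n
    wrap = begin
      n ∸ i + j              ≡⟨ cong (n ∸ i +_) (m+[n∸m]≡n i≤j) ⟨
      n ∸ i + (i + (j ∸ i))  ≡⟨ +-assoc (n ∸ i) i (j ∸ i) ⟨
      n ∸ i + i + (j ∸ i)    ≡⟨ cong (_+ (j ∸ i)) (m∸n+n≡m (<⇒≤ (≤-<-trans i≤j j<n))) ⟩
      n + (j ∸ i)            ≡⟨ +-comm n (j ∸ i) ⟩
      j ∸ i + n              ∎

  diff-> : ∀ {i j} → j < i → i < n → diff i j + i ≡ n + j
  diff-> {i} {j} j<i i<n = begin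
    diff i j + i           ≡⟨ cong (_+ i) (trans (diff-unfold i (<-trans j<i i<n)) (m<n⇒m%n≡m no-wrap)) ⟩
    n ∸ i + j + i          ≡⟨ +-assoc (n ∸ i) j i ⟩
    n ∸ i + (j + i)        ≡⟨ cong (n ∸ i +_) (+-comm j i) ⟩
    n ∸ i + (i + j)        ≡⟨ +-assoc (n ∸ i) i j ⟨
    n ∸ i + i + j          ≡⟨ cong (_+ j) (m∸n+n≡m (<⇒≤ i<n)) ⟩
    n + j                  ∎
    where
    no-wrap : n ∸ i + j < n
    no-wrap = subst (n ∸ i + j <_) (m∸n+n≡m (<⇒≤ i<n)) (+-monoʳ-< (n ∸ i) j<i)

  diff≡q⇒antipodal : ∀ {i j} → i < n → j < n → diff i j ≡ q → Antipodal i j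
  diff≡q⇒antipodal {i} {j} i<n j<n e with i ≤? j
  ... | yes i≤j = inj₁ (begin
    j              ≡⟨ m+[n∸m]≡n i≤j ⟨
    i + (j ∸ i)    ≡⟨ cong (i +_) (trans (sym (diff-≤ i≤j j<n)) e) ⟩
    i + q          ∎)
  ... | no i≰j = inj₂ (+-cancelˡ-≡ q i (j + q) (begin
    q + i          ≡⟨ cong (_+ i) e ⟨
    diff i j + i   ≡⟨ diff-> (≰⇒> i≰j) i<n ⟩
    n + j          ≡⟨ cong (_+ j) n≡q+q ⟩
    q + q + j      ≡⟨ +-assoc q q j ⟩
    q + (q + j)    ≡⟨ cong (q +_) (+-comm q j) ⟩
    q + (j + q)    ∎))

  antipodal⇒diff≡q : ∀ {i j} → i < n → j < n → Antipodal i j → diff i j ≡ q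
  antipodal⇒diff≡q {i} {j} i<n j<n (inj₁ j≡i+q) = begin
    diff i j       ≡⟨ diff-≤ (subst (i ≤_) (sym j≡i+q) (m≤m+n i q)) j<n ⟩
    j ∸ i          ≡⟨ cong (_∸ i) j≡i+q ⟩
    i + q ∸ i      ≡⟨ m+n∸m≡n i q ⟩
    q              ∎
  antipodal⇒diff≡q {i} {j} i<n j<n (inj₂ i≡j+q) = +-cancelʳ-≡ i (diff i j) q (begin
    diff i j + i   ≡⟨ diff-> (subst (j <_) (sym i≡j+q) (m<m+n j (>-nonZero⁻¹ q))) i<n ⟩
    n + j          ≡⟨ cong (_+ j) n≡q+q ⟩
    q + q + j      ≡⟨ +-assoc q q j ⟩
    q + (q + j)    ≡⟨ cong (q +_) (trans (+-comm q j) (sym i≡j+q)) ⟩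
    q + i          ∎)

  -- The class of an exponent is its residue mod q: antipodal exponents share it.
  class : ℕ → ℕ
  class i = i % q

  class<q : ∀ i → class i < q
  class<q i = m%n<n i q

  class-small : ∀ {c} → c < q → class c ≡ c
  class-small = m<n⇒m%n≡m

  class-shift : ∀ c → class (c + q) ≡ class c
  class-shift c = [m+n]%n≡m%n c q

  halves : ∀ {i} → i < n → (i ≡ class i) ⊎ (i ≡ class i + q)
  halves {i} i<n with i <? q
  ... | yes i<q = inj₁ (sym (class-small i<q))
  ... | no i≮q = inj₂ (begin
    i              ≡⟨ m∸n+n≡m q≤i ⟨
    i ∸ q + q      ≡⟨ cong (_+ q) (trans (sym (class-small i∸q<q)) (m≤n⇒[n∸m]%m≡n%m q≤i)) ⟩
    class i + q    ∎)
    where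
    q≤i : q ≤ i
    q≤i = ≮⇒≥ i≮q
    i∸q<q : i ∸ q < q
    i∸q<q = +-cancelʳ-< q (i ∸ q) q (subst₂ _<_ (sym (m∸n+n≡m q≤i)) n≡q+q i<n)

  antipodal⇒same-class : ∀ {i j} → Antipodal i j → class i ≡ class j
  antipodal⇒same-class {i} (inj₁ refl) = sym (class-shift i)
  antipodal⇒same-class {_} {j} (inj₂ refl) = class-shift j

  same-class⇒≡⊎antipodal : ∀ {i j} → i < n → j < n → class i ≡ class j → i ≡ j ⊎ Antipodal i j
  same-class⇒≡⊎antipodal i<n j<n e with halves i<n | halves j<n
  ... | inj₁ i≡c | inj₁ j≡c = inj₁ (trans i≡c (trans e (sym j≡c)))
  ... | inj₂ i≡c+q | inj₂ j≡c+q = inj₁ (trans i≡c+q (trans (cong (_+ q) e) (sym j≡c+q)))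
  ... | inj₁ i≡c | inj₂ j≡c+q = inj₂ (inj₁ (trans j≡c+q (cong (_+ q) (trans (sym e) (sym i≡c)))))
  ... | inj₂ i≡c+q | inj₁ j≡c = inj₂ (inj₂ (trans i≡c+q (cong (_+ q) (trans e (sym j≡c)))))

module Lambda (q : ℕ) (2≤q : 2 ≤ q) where

  instance
    q-nonZero : NonZero q
    q-nonZero = >-nonZero (≤-trans (s≤s z≤n) 2≤q)

  open HalfTurns q
  open Dihedral n
  open Metric Adj
  open GraphMetric Adj

  _≟ᴰ_ : DecidableEquality D
  _≟ᴰ_ = ≡-dec Fin._≟_ Bool._≟_

  -- The other layer: a walk of length 2 inside a layer passes through it.
  s≢not-s : ∀ s → s ≢ not s
  s≢not-s false ()
  s≢not-s true ()

  toℕ-rotation : ∀ i j → toℕ (addF (negF i) j) ≡ diff (toℕ i) (toℕ j)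
  toℕ-rotation i j = trans (Fin.toℕ-fromℕ< _) (cong (λ m → (m + toℕ j) % n) (Fin.toℕ-fromℕ< _))

  toℕ-rotation′ : ∀ i j → toℕ (addF i (negF j)) ≡ diff (toℕ j) (toℕ i)
  toℕ-rotation′ i j = trans (Fin.toℕ-fromℕ< _)
    (trans (cong (_% n) (+-comm (toℕ i) (toℕ (negF j))))
           (cong (λ m → (m + toℕ i) % n) (Fin.toℕ-fromℕ< _)))

  n/2≡q : n / 2 ≡ q
  n/2≡q = m*n/n≡m q 2

  -- Adjacency inside a layer: x⁻¹y is a rotation, and it lies in Ψ iff it is a^{n/2}.
  adj⇒antipodal : ∀ i j s → Adj (i , s) (j , s) → Antipodal (toℕ i) (toℕ j)
  adj⇒antipodal i j false (inj₂ (_ , e)) =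
    diff≡q⇒antipodal (Fin.toℕ<n i) (Fin.toℕ<n j) (trans (sym (toℕ-rotation i j)) (trans e n/2≡q))
  adj⇒antipodal i j true (inj₂ (_ , e)) = antipodal-sym
    (diff≡q⇒antipodal (Fin.toℕ<n j) (Fin.toℕ<n i) (trans (sym (toℕ-rotation′ i j)) (trans e n/2≡q)))

  antipodal⇒adj : ∀ i j s → Antipodal (toℕ i) (toℕ j) → Adj (i , s) (j , s)
  antipodal⇒adj i j false a = inj₂ (refl , (begin
    toℕ (addF (negF i) j)    ≡⟨ toℕ-rotation i j ⟩
    diff (toℕ i) (toℕ j)     ≡⟨ antipodal⇒diff≡q (Fin.toℕ<n i) (Fin.toℕ<n j) a ⟩
    q                        ≡⟨ n/2≡q ⟨
    n / 2                    ∎))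
  antipodal⇒adj i j true a = inj₂ (refl , (begin
    toℕ (addF i (negF j))    ≡⟨ toℕ-rotation′ i j ⟩
    diff (toℕ j) (toℕ i)     ≡⟨ antipodal⇒diff≡q (Fin.toℕ<n j) (Fin.toℕ<n i) (antipodal-sym a) ⟩
    q                        ≡⟨ n/2≡q ⟨
    n / 2                    ∎))

  -- Between the two layers every pair is adjacent: x⁻¹y is a reflection a^k b ∈ Ψ.
  adj-across : ∀ i j {s t} → s ≢ t → Adj (i , s) (j , t)
  adj-across i j {false} {false} s≢t = ⊥-elim (s≢t refl)
  adj-across i j {false} {true}  _   = inj₁ refl
  adj-across i j {true}  {false} _   = inj₁ refl
  adj-across i j {true}  {true}  s≢t = ⊥-elim (s≢t refl)

  dist-across : ∀ i j {s t} → s ≢ t → Dist (i , s) (j , t) 1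
  dist-across i j s≢t = dist-one (λ e → s≢t (cong proj₂ e)) (adj-across i j s≢t)

  dist-antipodal : ∀ i j s → Antipodal (toℕ i) (toℕ j) → Dist (i , s) (j , s) 1
  dist-antipodal i j s a = dist-one (λ e → antipodal⇒≢ a (cong (toℕ ∘ proj₁) e)) (antipodal⇒adj i j s a)

  dist-far : ∀ i j s → class (toℕ i) ≢ class (toℕ j) → Dist (i , s) (j , s) 2
  dist-far i j s classes≢ = dist-two
    (λ e → classes≢ (cong (class ∘ toℕ ∘ proj₁) e))
    (λ uv → classes≢ (antipodal⇒same-class (adj⇒antipodal i j s uv)))
    (step (adj-across i i (s≢not-s s)) (step (adj-across i j (s≢not-s s ∘ sym)) here))

  dist-near : ∀ i j s → class (toℕ i) ≡ class (toℕ j) →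
    (i ≡ j × Dist (i , s) (j , s) 0) ⊎ (Antipodal (toℕ i) (toℕ j) × Dist (i , s) (j , s) 1)
  dist-near i j s classes≡ with same-class⇒≡⊎antipodal (Fin.toℕ<n i) (Fin.toℕ<n j) classes≡
  ... | inj₁ i≡j rewrite Fin.toℕ-injective i≡j = inj₁ (refl , dist-zero)
  ... | inj₂ a = inj₂ (a , dist-antipodal i j s a)

  q≤n : q ≤ n
  q≤n = <⇒≤ q<n

  lower : ∀ {c} → c < q → Fin n
  lower c<q = fromℕ< (<-≤-trans c<q q≤n)

  upper : ∀ {c} → c < q → Fin n
  upper {c} c<q = fromℕ< (subst (c + q <_) (sym n≡q+q) (+-monoˡ-< q c<q))

  class-lower : ∀ {c} (c<q : c < q) → class (toℕ (lower c<q)) ≡ c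
  class-lower c<q = trans (cong class (Fin.toℕ-fromℕ< _)) (class-small c<q)

  class-upper : ∀ {c} (c<q : c < q) → class (toℕ (upper c<q)) ≡ c
  class-upper {c} c<q = begin
    class (toℕ (upper c<q))  ≡⟨ cong class (Fin.toℕ-fromℕ< _) ⟩
    class (c + q)            ≡⟨ class-shift c ⟩
    class c                  ≡⟨ class-small c<q ⟩
    c                        ∎

  shadow : D → D
  shadow (i , s) = lower (class<q (toℕ i)) , s

  -- Fin 2 names the two layers, so that Fin n ≅ Fin q × Fin 2 indexes the lower halves.
  layer : Fin 2 → Bool
  layer Fin.zero = false
  layer (Fin.suc Fin.zero) = true

  layer-injective : ∀ {l l′} → layer l ≡ layer l′ → l ≡ l′
  layer-injective {Fin.zero}          {Fin.zero}          _ = refl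
  layer-injective {Fin.suc Fin.zero}  {Fin.suc Fin.zero}  _ = refl
  layer-injective {Fin.zero}          {Fin.suc Fin.zero}  ()
  layer-injective {Fin.suc Fin.zero}  {Fin.zero}          ()

  layerIndex : Bool → Fin 2
  layerIndex false = Fin.zero
  layerIndex true = Fin.suc Fin.zero

  layer-layerIndex : ∀ s → layer (layerIndex s) ≡ s
  layer-layerIndex false = refl
  layer-layerIndex true = refl

  lowerVertex : Fin q × Fin 2 → D
  lowerVertex (c , l) = lower (Fin.toℕ<n c) , layer l

  basis : Fin n → D
  basis k = lowerVertex (remQuot {q} 2 k)

  lowerVertex-injective : ∀ {p p′} → lowerVertex p ≡ lowerVertex p′ → p ≡ p′
  lowerVertex-injective {c , l} {c′ , l′} e = cong₂ _,_
    (Fin.toℕ-injective (trans (sym (class-lower (Fin.toℕ<n c)))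
      (trans (cong (class ∘ toℕ ∘ proj₁) e) (class-lower (Fin.toℕ<n c′)))))
    (layer-injective (cong proj₂ e))

  basis-injective : ∀ {k k′} → basis k ≡ basis k′ → k ≡ k′
  basis-injective {k} {k′} e = begin
    k                                  ≡⟨ Fin.combine-remQuot {q} 2 k ⟨
    uncurry combine (remQuot {q} 2 k)  ≡⟨ cong (uncurry combine) (lowerVertex-injective e) ⟩
    uncurry combine (remQuot {q} 2 k′) ≡⟨ Fin.combine-remQuot {q} 2 k′ ⟩
    k′                                 ∎

  S : List D
  S = map basis (allFin n)

  length-S : length S ≡ n
  length-S = trans (length-map basis (allFin n)) (length-tabulate (λ k → k))

  unique-S : Unique S
  unique-S = Unique.map⁺ basis-injective (Unique.allFin⁺ n)

  ∈-S : ∀ {i} s → toℕ i < q → (i , s) ∈ S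
  ∈-S {i} s i<q = subst (_∈ S) basis-k≡ (∈-map⁺ basis (∈-allFin k))
    where
    k : Fin n
    k = combine (fromℕ< i<q) (layerIndex s)
    basis-k≡ : basis k ≡ (i , s)
    basis-k≡ = begin
      lowerVertex (remQuot {q} 2 k)               ≡⟨ cong lowerVertex (Fin.remQuot-combine _ _) ⟩
      lowerVertex (fromℕ< i<q , layerIndex s)     ≡⟨ cong₂ _,_ (Fin.toℕ-injective toℕ-lower) (layer-layerIndex s) ⟩
      i , s                                       ∎
      where
      toℕ-lower : toℕ (lower (Fin.toℕ<n (fromℕ< i<q))) ≡ toℕ i
      toℕ-lower = trans (Fin.toℕ-fromℕ< _) (Fin.toℕ-fromℕ< i<q)

  lower∈S : ∀ {c} (c<q : c < q) s → (lower c<q , s) ∈ S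
  lower∈S c<q s = ∈-S s (subst (_< q) (sym (Fin.toℕ-fromℕ< _)) c<q)

  shadow∈S : ∀ u → shadow u ∈ S
  shadow∈S (i , s) = lower∈S (class<q (toℕ i)) s

  shadow-of-class : ∀ i s {c} (c<q : c < q) → class (toℕ i) ≡ c → shadow (i , s) ≡ (lower c<q , s)
  shadow-of-class i s c<q e =
    cong (_, s) (Fin.toℕ-injective (trans (Fin.toℕ-fromℕ< _) (trans e (sym (Fin.toℕ-fromℕ< _)))))

  class-shadow : ∀ i s → class (toℕ i) ≡ class (toℕ (proj₁ (shadow (i , s))))
  class-shadow i s = sym (class-lower (class<q (toℕ i)))

  shadow-near : ∀ i s → ∃ λ a → a ≤ 1 × Dist (i , s) (shadow (i , s)) a
  shadow-near i s with dist-near i _ s (class-shadow i s)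
  ... | inj₁ (_ , d₀) = 0 , z≤n , d₀
  ... | inj₂ (_ , d₁) = 1 , s≤s z≤n , d₁

  -- Within a layer, the shadow of u lies at different distances from u and from any other v:
  -- v is either in another class (distance 2) or the other member of u's class.
  shadow-separates : ∀ i j s → i ≢ j →
    ∃ λ a → ∃ λ b → a ≢ b × Dist (i , s) (shadow (i , s)) a × Dist (j , s) (shadow (i , s)) b
  shadow-separates i j s i≢j with class (toℕ j) ≟ class (toℕ i)
  ... | no classes≢ with shadow-near i s
  ...   | a , a≤1 , d = a , 2 , <⇒≢ (s≤s a≤1) , d ,
          dist-far j _ s (λ e → classes≢ (trans e (sym (class-shadow i s))))
  shadow-separates i j s i≢j | yes classes≡
    with dist-near i _ s (class-shadow i s) | dist-near j _ s (trans classes≡ (class-shadow i s))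
  ... | inj₁ (i≡r , _) | inj₁ (j≡r , _) = ⊥-elim (i≢j (trans i≡r (sym j≡r)))
  ... | inj₁ (_ , d₀) | inj₂ (_ , d₁) = 0 , 1 , (λ ()) , d₀ , d₁
  ... | inj₂ (_ , d₁) | inj₁ (_ , d₀) = 1 , 0 , (λ ()) , d₁ , d₀
  ... | inj₂ (i-r , _) | inj₂ (j-r , _) = ⊥-elim (i≢j (Fin.toℕ-injective
          (antipode-unique (Fin.toℕ<n i) (Fin.toℕ<n j) (antipodal-sym i-r) (antipodal-sym j-r))))

  another-class : ∀ c → ∃ λ w → w < q × w ≢ c
  another-class zero = 1 , 2≤q , λ ()
  another-class (suc _) = 0 , ≤-trans (s≤s z≤n) 2≤q , λ ()

  S-resolving : IsDoublyResolvingSet S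
  S-resolving (i , s) (j , t) u≢v with s Bool.≟ t
  ... | yes refl with shadow-separates i j s (λ i≡j → u≢v (cong (_, s) i≡j))
  ...   | a , b , a≢b , ua , va =
    -- a vertex z of the other layer is adjacent to both, so z and the shadow of u resolve them
    (proj₁ (shadow (i , s)) , not s) , shadow (i , s) , lower∈S (class<q (toℕ i)) (not s) , shadow∈S (i , s) ,
    resolves (dist-across i _ (s≢not-s s)) ua (dist-across j _ (s≢not-s s)) va (λ e → a≢b (sym (suc-injective e)))
  S-resolving (i , s) (j , t) u≢v | no s≢t with another-class (class (toℕ i)) | shadow-near i s
  ... | w , w<q , w≢c | a , a≤1 , ua =
    -- both vertices lie in u's layer: v sees them at distance 1, u at distances a ≤ 1 and 2
    shadow (i , s) , (lower w<q , s) , shadow∈S (i , s) , lower∈S w<q s ,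
    resolves ua (dist-far i _ s (λ e → w≢c (sym (trans e (class-lower w<q)))))
      (dist-across j _ (s≢t ∘ sym)) (dist-across j _ (s≢t ∘ sym))
      (λ e → <⇒≢ (s≤s a≤1) (+-cancelʳ-≡ 1 a 2 e))

  lower-upper-antipodal : ∀ {c} (c<q : c < q) → Antipodal (toℕ (lower c<q)) (toℕ (upper c<q))
  lower-upper-antipodal {c} c<q = inj₁ (trans (Fin.toℕ-fromℕ< _) (cong (_+ q) (sym (Fin.toℕ-fromℕ< _))))

  twins-distinct : ∀ {c} (c<q : c < q) (s : Bool) → (lower c<q , s) ≢ (upper c<q , s)
  twins-distinct c<q s e = antipodal⇒≢ (lower-upper-antipodal c<q) (cong (toℕ ∘ proj₁) e)

  -- Another vertex is across (distance 1 to both) or in another class (distance 2 to both).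
  twins-equidistant : ∀ {c} (c<q : c < q) s w → w ≢ (lower c<q , s) → w ≢ (upper c<q , s) →
    Equidistant w (lower c<q , s) (upper c<q , s)
  twins-equidistant {c} c<q s (j , t) w≢lower w≢upper with s Bool.≟ t
  ... | no s≢t = 1 , dist-across _ j s≢t , dist-across _ j s≢t
  ... | yes refl = 2 , dist-far _ j s (λ e → j∉class (trans (sym e) (class-lower c<q)))
                     , dist-far _ j s (λ e → j∉class (trans (sym e) (class-upper c<q)))
    where
    j∉class : class (toℕ j) ≢ c
    j∉class j∈c with halves (Fin.toℕ<n j)
    ... | inj₁ j≡cⱼ = w≢lower (cong (_, s) (Fin.toℕ-injective
            (trans j≡cⱼ (trans j∈c (sym (Fin.toℕ-fromℕ< _))))))
    ... | inj₂ j≡cⱼ+q = w≢upper (cong (_, s) (Fin.toℕ-injective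
            (trans j≡cⱼ+q (trans (cong (_+ q) j∈c) (sym (Fin.toℕ-fromℕ< _))))))

  -- Every doubly resolving set meets each of the n twin pairs, which have disjoint shadows.
  lower-bound : ∀ S′ → IsDoublyResolvingSet S′ → n ≤ length S′
  lower-bound S′ drs = injection-into-list S′ (proj₁ ∘ chosen) (proj₁ ∘ proj₂ ∘ chosen) chosen-injective
    where
    -- S′ contains a^c b^s or a^{c+q} b^s; either way its shadow is a^c b^s.
    twin-in-S′ : ∀ {c} (c<q : c < q) s → Σ D λ x → x ∈ S′ × shadow x ≡ (lower c<q , s)
    twin-in-S′ c<q s with drs-meets-twins _≟ᴰ_ (twins-equidistant c<q s) (twins-distinct c<q s) drs
    ... | inj₁ ∈S′ = _ , ∈S′ , shadow-of-class (lower c<q) s c<q (class-lower c<q)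
    ... | inj₂ ∈S′ = _ , ∈S′ , shadow-of-class (upper c<q) s c<q (class-upper c<q)

    chosen : ∀ k → Σ D λ x → x ∈ S′ × shadow x ≡ basis k
    chosen k = twin-in-S′ (Fin.toℕ<n (proj₁ p)) (layer (proj₂ p))
      where p = remQuot {q} 2 k

    chosen-injective : ∀ {k k′} → proj₁ (chosen k) ≡ proj₁ (chosen k′) → k ≡ k′
    chosen-injective {k} {k′} e = basis-injective (begin
      basis k                    ≡⟨ proj₂ (proj₂ (chosen k)) ⟨
      shadow (proj₁ (chosen k))  ≡⟨ cong shadow e ⟩
      shadow (proj₁ (chosen k′)) ≡⟨ proj₂ (proj₂ (chosen k′)) ⟩
      basis k′                   ∎)

-- n ≥ 4 with n = 2q forces q ≥ 2, which Λ needs for a second class below q.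
half≥2 : ∀ q → 4 ≤ q * 2 → 2 ≤ q
half≥2 zero ()
half≥2 (suc zero) (s≤s (s≤s ()))
half≥2 (suc (suc q)) _ = s≤s (s≤s z≤n)

theorem3p6 : (n : ℕ) .{{_ : NonZero n}} → 4 ≤ n → 2 ∣ n →
    let open Dihedral n in
    let open Metric Adj in
    (∃ λ (S : List D) → Unique S × length S ≡ n × IsDoublyResolvingSet S)
    × (∀ (S : List D) → Unique S → IsDoublyResolvingSet S → n ≤ length S)
theorem3p6 .(q * 2) 4≤n (divides q refl) =
  (S , unique-S , length-S , S-resolving) , λ S′ _ drs → lower-bound S′ drs
  where open Lambda q (half≥2 q 4≤n)
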